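{- Let $m\ge n\ge 1$ be integers and $\lambda$ a partition inside the $(n-1)\times m$ board. Then for every $j$, \[ H^{m,n}_j(\lambda)=[m+1-n]\,H^{m,n-1}_j(\lambda). \]
   Context: $q$ is an indeterminate; $[x]=(1-q^x)/(1-q)$, $[n]_k=[n][n-1]\cdots[n-k+1]$ ($[n]_0=1$), $[n]!=[n]_n$, $(a;q)_k=\prod_{i=0}^{k-1}(1-aq^i)$. A partition $\lambda$ is identified with its Ferrers board (rows from the top, columns from the left, row $i$ having $\lambda_i$ cells); $|\lambda|$ is its number of cells; $\lambda$ is inside the $n\times m$ board if $\ell(\lambda)\le n$, $\lambda_1\le m$. $R_k(\lambda)=\sum_p q^{\mathrm{inv}(p)}$ over placements of $k$ non-attacking rooks on $\lambda$, with $\mathrm{inv}(p)$ the number of cells of $\lambda$ having no rook and neither to the left of a rook in the same row nor above a rook in the same column. For $m\ge n$ and $\lambda$ inside the $n\times m$ board, $H^{m,n}_i(\lambda)$ ($0\le i\le n$) are defined by $\sum_{i=0}^n H^{m,n}_i(\lambda)x^i=\frac{q^{ -|\lambda|}}{[m-n]!}\sum_{i=0}^n R_i(\lambda)[m-i]!(-1)^iq^{mi-\binom i2}(x;q)_i$, and $H^{m,n}_i(\lambda)=0$ for $i<0$ or $i>n$. -}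

module Defs where

open import Data.Nat as ℕ using (ℕ; zero; suc; _∸_; _≤_; _≤ᵇ_)
open import Data.Integer as ℤ using (ℤ; +_; -[1+_])
open import Data.List using (List; []; _∷_; map; replicate; _++_; length; upTo; concatMap; foldr; filterᵇ)
open import Data.Nat.ListAction using (sum)
open import Data.List.Relation.Unary.All using (All)
open import Data.List.Relation.Unary.Linked using (Linked)
open import Data.Maybe using (Maybe; just; nothing)
open import Data.Bool using (Bool; true; false; _∧_; not; if_then_else_)
open import Data.Product using (_×_)
open import Relation.Binary.PropositionalEquality using (_≡_)

-- Polynomials in q with integer coefficients: ℤ[q]
-- (list of coefficients, position k = coefficient of q^k)

Poly : Set
Poly = List ℤ

0ₚ : Poly
0ₚ = []

1ₚ : Poly
1ₚ = + 1 ∷ []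

_+ₚ_ : Poly → Poly → Poly
[] +ₚ r = r
(a ∷ p) +ₚ [] = a ∷ p
(a ∷ p) +ₚ (b ∷ r) = (a ℤ.+ b) ∷ (p +ₚ r)

-ₚ_ : Poly → Poly
-ₚ p = map ℤ.-_ p

scaleₚ : ℤ → Poly → Poly
scaleₚ a = map (a ℤ.*_)

_*ₚ_ : Poly → Poly → Poly
[] *ₚ r = []
(a ∷ p) *ₚ r = scaleₚ a r +ₚ (+ 0 ∷ (p *ₚ r))

qpow : ℕ → Poly
qpow k = replicate k (+ 0) ++ (+ 1 ∷ [])

coeff : Poly → ℕ → ℤ
coeff [] k = + 0
coeff (a ∷ p) zero = a
coeff (a ∷ p) (suc k) = coeff p k

-- equality in ℤ[q] (ignoring trailing zeros)
_≈ₚ_ : Poly → Poly → Set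
p ≈ₚ r = ∀ k → coeff p k ≡ coeff r k

signₚ : ℕ → Poly → Poly
signₚ zero p = p
signₚ (suc i) p = -ₚ (signₚ i p)

sumₚ : List Poly → Poly
sumₚ = foldr _+ₚ_ 0ₚ

Σ≤ : ℕ → (ℕ → Poly) → Poly
Σ≤ n f = sumₚ (map f (upTo (suc n)))

-- q-numbers: [x] = (1-q^x)/(1-q) = 1 + q + ... + q^(x-1)

qnum : ℕ → Poly
qnum x = replicate x (+ 1)

qfact : ℕ → Poly
qfact zero = 1ₚ
qfact (suc n) = qnum (suc n) *ₚ qfact n

choose2 : ℕ → ℕ
choose2 zero = zero
choose2 (suc i) = i ℕ.+ choose2 i

-- Rational functions: the fraction field ℚ(q) = Frac ℤ[q]
-- num/den, equality by cross multiplication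

record QF : Set where
  constructor _/ₚ_
  field
    num : Poly
    den : Poly
open QF public

_≈_ : QF → QF → Set
a ≈ b = (num a *ₚ den b) ≈ₚ (num b *ₚ den a)

0Q : QF
0Q = 0ₚ /ₚ 1ₚ

_·Q_ : Poly → QF → QF
p ·Q (a /ₚ b) = (p *ₚ a) /ₚ b

-- Polynomials in x with coefficients in ℤ[q]

XPoly : Set
XPoly = List Poly

_+ₓ_ : XPoly → XPoly → XPoly
[] +ₓ r = r
(a ∷ p) +ₓ [] = a ∷ p
(a ∷ p) +ₓ (b ∷ r) = (a +ₚ b) ∷ (p +ₓ r)

-- multiply by (1 - c x)
mulLin : Poly → XPoly → XPoly
mulLin c ps = ps +ₓ (0ₚ ∷ map (λ p → -ₚ (c *ₚ p)) ps)

-- (x;q)_i = (1-x)(1-xq)...(1-xq^(i-1))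
xqPoch : ℕ → XPoly
xqPoch zero = 1ₚ ∷ []
xqPoch (suc i) = mulLin (qpow i) (xqPoch i)

coeffₓ : XPoly → ℕ → Poly
coeffₓ [] j = 0ₚ
coeffₓ (a ∷ p) zero = a
coeffₓ (a ∷ p) (suc j) = coeffₓ p j

-- Partitions / Ferrers boards (row i has λ_i cells, rows from the top)

IsPartition : List ℕ → Set
IsPartition la = Linked ℕ._≥_ la × All (1 ≤_) la

Inside : ℕ → ℕ → List ℕ → Set
Inside n m la = length la ≤ n × All (_≤ m) la

size : List ℕ → ℕ
size = sum

-- Rook placements: one entry per row (top to bottom), either no rook
-- or the column (0-based) of the rook in that row.

Placement : Set
Placement = List (Maybe ℕ)

rowPlacements : List ℕ → List Placement
rowPlacements [] = [] ∷ []
rowPlacements (l ∷ ls) =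
  concatMap (λ rest → (nothing ∷ rest) ∷ map (λ c → just c ∷ rest) (upTo l))
            (rowPlacements ls)

columns : Placement → List ℕ
columns [] = []
columns (nothing ∷ p) = columns p
columns (just c ∷ p) = c ∷ columns p

memᵇ : ℕ → List ℕ → Bool
memᵇ x [] = false
memᵇ x (y ∷ ys) = if x ℕ.≡ᵇ y then true else memᵇ x ys

distinctᵇ : List ℕ → Bool
distinctᵇ [] = true
distinctᵇ (x ∷ xs) = not (memᵇ x xs) ∧ distinctᵇ xs

placements : List ℕ → List Placement
placements la = filterᵇ (λ p → distinctᵇ (columns p)) (rowPlacements la)

nrooks : Placement → ℕ
nrooks p = length (columns p)

rowOk : Maybe ℕ → ℕ → Bool
rowOk nothing j = true
rowOk (just c) j = c ℕ.<ᵇ j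

countᵇ : (ℕ → Bool) → List ℕ → ℕ
countᵇ f [] = 0
countᵇ f (x ∷ xs) = if f x then suc (countᵇ f xs) else countᵇ f xs

-- inv(p): cells with no rook, not left of a rook in their row, and not
-- above a rook in their column (rows below are the later rows)
inv : List ℕ → Placement → ℕ
inv [] p = 0
inv (l ∷ ls) [] = 0
inv (l ∷ ls) (r ∷ rs) =
  countᵇ (λ j → rowOk r j ∧ not (memᵇ j (columns rs))) (upTo l) ℕ.+ inv ls rs

Rk : List ℕ → ℕ → Poly
Rk la k = sumₚ (map (λ p → qpow (inv la p))
                    (filterᵇ (λ p → nrooks p ℕ.≡ᵇ k) (placements la)))

-- H^{m,n}_j(λ) ∈ ℚ(q):
-- Σ_i H_i x^i = q^{-|λ|}/[m-n]! Σ_{i=0}^n R_i [m-i]! (-1)^i q^{mi - C(i,2)} (x;q)_i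
-- and H_j = 0 for j < 0 or j > n.

Hnum : ℕ → ℕ → List ℕ → ℕ → Poly
Hnum m n la j =
  Σ≤ n (λ i → signₚ i (Rk la i *ₚ (qfact (m ∸ i) *ₚ
           (qpow (m ℕ.* i ∸ choose2 i) *ₚ coeffₓ (xqPoch i) j))))

H : ℕ → ℕ → List ℕ → ℤ → QF
H m n la -[1+ _ ] = 0Q
H m n la (+ j) =
  if j ≤ᵇ n then Hnum m n la j /ₚ (qpow (size la) *ₚ qfact (m ∸ n)) else 0Q

-- A board with at most n − 1 rows carries no placement of n rooks, so R_n(λ) = 0 and the
-- i = n summand in the definition of H^{m,n} vanishes. Hence H^{m,n}_j and H^{m,n-1}_j
-- have the same numerator, while their denominators q^|λ| [m−n]! and q^|λ| [m−n+1]!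
-- differ by the factor [m+1−n]. For j = n the common numerator is itself zero, because
-- (x;q)_i has degree i < n.
module Submission where

open import Defs
open import Data.Nat as ℕ using (ℕ; zero; suc; _∸_; _≤_; _<_; z≤n; s≤s; _≤ᵇ_; _≡ᵇ_)
import Data.Nat.Properties as ℕ
open import Data.Integer as ℤ using (ℤ; +_; -[1+_])
import Data.Integer.Properties as ℤ
open import Data.List using (List; []; _∷_; map; length; upTo; _++_; foldr)
import Data.List.Properties as List
open import Data.List.Relation.Unary.All as All using (All; []; _∷_)
import Data.List.Relation.Unary.All.Properties as All
open import Data.Maybe using (just; nothing)
open import Data.Bool using (true; false)
open import Data.Product using (_,_)
open import Data.Empty using (⊥-elim)
open import Relation.Nullary using (yes; no)
open import Relation.Nullary.Decidable using (T?)
open import Function using (_∘_; id)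
open import Level using (0ℓ)
open import Algebra.Bundles using (CommutativeSemigroup)
import Algebra.Properties.CommutativeSemigroup as CommutativeSemigroupProperties
open import Relation.Binary.Bundles using (Setoid)
open import Relation.Binary.Structures using (IsEquivalence)
import Relation.Binary.Reasoning.Setoid as SetoidReasoning
open import Relation.Binary.PropositionalEquality
  using (_≡_; refl; sym; trans; cong; cong₂; module ≡-Reasoning)

-- Arithmetic in ℤ[q] up to trailing zeros

-- Wrapping _≈ₚ_ in a record lets Agda recover both polynomials from a proof.
infix 4 _≋_
record _≋_ (p r : Poly) : Set where
  constructor mk≋
  field coeff-≡ : p ≈ₚ r
open _≋_

≋-refl : ∀ {p} → p ≋ p
≋-refl = mk≋ λ _ → refl

≋-sym : ∀ {p r} → p ≋ r → r ≋ p
≋-sym (mk≋ e) = mk≋ λ k → sym (e k)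

≋-trans : ∀ {p r s} → p ≋ r → r ≋ s → p ≋ s
≋-trans (mk≋ e) (mk≋ e′) = mk≋ λ k → trans (e k) (e′ k)

≋-reflexive : ∀ {p r} → p ≡ r → p ≋ r
≋-reflexive refl = ≋-refl

≋-isEquivalence : IsEquivalence _≋_
≋-isEquivalence = record { refl = ≋-refl ; sym = ≋-sym ; trans = ≋-trans }

≋-setoid : Setoid 0ℓ 0ℓ
≋-setoid = record { isEquivalence = ≋-isEquivalence }

module ≋-Reasoning = SetoidReasoning ≋-setoid

∷-cong : ∀ {a b p r} → a ≡ b → p ≋ r → a ∷ p ≋ b ∷ r
∷-cong a≡b (mk≋ e) = mk≋ λ { zero → a≡b ; (suc k) → e k }

0∷-≋0ₚ : ∀ {p} → p ≋ 0ₚ → + 0 ∷ p ≋ 0ₚ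
0∷-≋0ₚ (mk≋ e) = mk≋ λ { zero → refl ; (suc k) → e k }

coeff-+ₚ : ∀ p r k → coeff (p +ₚ r) k ≡ coeff p k ℤ.+ coeff r k
coeff-+ₚ []      r       k       = sym (ℤ.+-identityˡ (coeff r k))
coeff-+ₚ (a ∷ p) []      k       = sym (ℤ.+-identityʳ (coeff (a ∷ p) k))
coeff-+ₚ (a ∷ p) (b ∷ r) zero    = refl
coeff-+ₚ (a ∷ p) (b ∷ r) (suc k) = coeff-+ₚ p r k

coeff-scaleₚ : ∀ a r k → coeff (scaleₚ a r) k ≡ a ℤ.* coeff r k
coeff-scaleₚ a []      k       = sym (ℤ.*-zeroʳ a)
coeff-scaleₚ a (b ∷ r) zero    = refl
coeff-scaleₚ a (b ∷ r) (suc k) = coeff-scaleₚ a r k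

coeff--ₚ : ∀ p k → coeff (-ₚ p) k ≡ ℤ.- coeff p k
coeff--ₚ []      k       = refl
coeff--ₚ (a ∷ p) zero    = refl
coeff--ₚ (a ∷ p) (suc k) = coeff--ₚ p k

+ₚ-cong : ∀ {p p′ r r′} → p ≋ p′ → r ≋ r′ → p +ₚ r ≋ p′ +ₚ r′
+ₚ-cong {p} {p′} {r} {r′} (mk≋ e) (mk≋ e′) = mk≋ λ k → begin
  coeff (p +ₚ r) k          ≡⟨ coeff-+ₚ p r k ⟩
  coeff p k ℤ.+ coeff r k   ≡⟨ cong₂ ℤ._+_ (e k) (e′ k) ⟩
  coeff p′ k ℤ.+ coeff r′ k ≡⟨ coeff-+ₚ p′ r′ k ⟨
  coeff (p′ +ₚ r′) k        ∎
  where open ≡-Reasoning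

+ₚ-comm : ∀ p r → p +ₚ r ≋ r +ₚ p
+ₚ-comm p r = mk≋ λ k → begin
  coeff (p +ₚ r) k        ≡⟨ coeff-+ₚ p r k ⟩
  coeff p k ℤ.+ coeff r k ≡⟨ ℤ.+-comm (coeff p k) (coeff r k) ⟩
  coeff r k ℤ.+ coeff p k ≡⟨ coeff-+ₚ r p k ⟨
  coeff (r +ₚ p) k        ∎
  where open ≡-Reasoning

+ₚ-assoc : ∀ p r s → (p +ₚ r) +ₚ s ≋ p +ₚ (r +ₚ s)
+ₚ-assoc p r s = mk≋ λ k → begin
  coeff ((p +ₚ r) +ₚ s) k                   ≡⟨ coeff-+ₚ (p +ₚ r) s k ⟩
  coeff (p +ₚ r) k ℤ.+ coeff s k            ≡⟨ cong (ℤ._+ coeff s k) (coeff-+ₚ p r k) ⟩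
  (coeff p k ℤ.+ coeff r k) ℤ.+ coeff s k   ≡⟨ ℤ.+-assoc (coeff p k) (coeff r k) (coeff s k) ⟩
  coeff p k ℤ.+ (coeff r k ℤ.+ coeff s k)   ≡⟨ cong (ℤ._+_ (coeff p k)) (coeff-+ₚ r s k) ⟨
  coeff p k ℤ.+ coeff (r +ₚ s) k            ≡⟨ coeff-+ₚ p (r +ₚ s) k ⟨
  coeff (p +ₚ (r +ₚ s)) k                   ∎
  where open ≡-Reasoning

+ₚ-commutativeSemigroup : CommutativeSemigroup 0ℓ 0ℓ
+ₚ-commutativeSemigroup = record
  { Carrier = Poly
  ; _≈_ = _≋_
  ; _∙_ = _+ₚ_
  ; isCommutativeSemigroup = record
    { isSemigroup = record
      { isMagma = record
        { isEquivalence = ≋-isEquivalence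
        ; ∙-cong = +ₚ-cong
        }
      ; assoc = +ₚ-assoc
      }
    ; comm = +ₚ-comm
    }
  }

open CommutativeSemigroupProperties +ₚ-commutativeSemigroup
  using () renaming (interchange to +ₚ-interchange; x∙yz≈y∙xz to +ₚ-leftComm)

+ₚ-identityʳ : ∀ p → p +ₚ 0ₚ ≋ p
+ₚ-identityʳ []      = ≋-refl
+ₚ-identityʳ (a ∷ p) = ≋-refl

scaleₚ-cong : ∀ a {r r′} → r ≋ r′ → scaleₚ a r ≋ scaleₚ a r′
scaleₚ-cong a {r} {r′} (mk≋ e) = mk≋ λ k → begin
  coeff (scaleₚ a r) k  ≡⟨ coeff-scaleₚ a r k ⟩
  a ℤ.* coeff r k       ≡⟨ cong (a ℤ.*_) (e k) ⟩
  a ℤ.* coeff r′ k      ≡⟨ coeff-scaleₚ a r′ k ⟨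
  coeff (scaleₚ a r′) k ∎
  where open ≡-Reasoning

scaleₚ-zero : ∀ r → scaleₚ (+ 0) r ≋ 0ₚ
scaleₚ-zero r = mk≋ (coeff-scaleₚ (+ 0) r)

scaleₚ-assoc : ∀ a b r → scaleₚ (a ℤ.* b) r ≋ scaleₚ a (scaleₚ b r)
scaleₚ-assoc a b r = mk≋ λ k → begin
  coeff (scaleₚ (a ℤ.* b) r) k   ≡⟨ coeff-scaleₚ (a ℤ.* b) r k ⟩
  (a ℤ.* b) ℤ.* coeff r k        ≡⟨ ℤ.*-assoc a b (coeff r k) ⟩
  a ℤ.* (b ℤ.* coeff r k)        ≡⟨ cong (a ℤ.*_) (coeff-scaleₚ b r k) ⟨
  a ℤ.* coeff (scaleₚ b r) k     ≡⟨ coeff-scaleₚ a (scaleₚ b r) k ⟨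
  coeff (scaleₚ a (scaleₚ b r)) k ∎
  where open ≡-Reasoning

scaleₚ-distribʳ-+ : ∀ a b r → scaleₚ (a ℤ.+ b) r ≋ scaleₚ a r +ₚ scaleₚ b r
scaleₚ-distribʳ-+ a b r = mk≋ λ k → begin
  coeff (scaleₚ (a ℤ.+ b) r) k                       ≡⟨ coeff-scaleₚ (a ℤ.+ b) r k ⟩
  (a ℤ.+ b) ℤ.* coeff r k                            ≡⟨ ℤ.*-distribʳ-+ (coeff r k) a b ⟩
  a ℤ.* coeff r k ℤ.+ b ℤ.* coeff r k                ≡⟨ cong₂ ℤ._+_ (coeff-scaleₚ a r k) (coeff-scaleₚ b r k) ⟨
  coeff (scaleₚ a r) k ℤ.+ coeff (scaleₚ b r) k      ≡⟨ coeff-+ₚ (scaleₚ a r) (scaleₚ b r) k ⟨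
  coeff (scaleₚ a r +ₚ scaleₚ b r) k                 ∎
  where open ≡-Reasoning

scaleₚ-distribˡ-+ₚ : ∀ a r s → scaleₚ a (r +ₚ s) ≋ scaleₚ a r +ₚ scaleₚ a s
scaleₚ-distribˡ-+ₚ a r s = mk≋ λ k → begin
  coeff (scaleₚ a (r +ₚ s)) k                        ≡⟨ coeff-scaleₚ a (r +ₚ s) k ⟩
  a ℤ.* coeff (r +ₚ s) k                             ≡⟨ cong (a ℤ.*_) (coeff-+ₚ r s k) ⟩
  a ℤ.* (coeff r k ℤ.+ coeff s k)                    ≡⟨ ℤ.*-distribˡ-+ a (coeff r k) (coeff s k) ⟩
  a ℤ.* coeff r k ℤ.+ a ℤ.* coeff s k                ≡⟨ cong₂ ℤ._+_ (coeff-scaleₚ a r k) (coeff-scaleₚ a s k) ⟨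
  coeff (scaleₚ a r) k ℤ.+ coeff (scaleₚ a s) k      ≡⟨ coeff-+ₚ (scaleₚ a r) (scaleₚ a s) k ⟨
  coeff (scaleₚ a r +ₚ scaleₚ a s) k                 ∎
  where open ≡-Reasoning

*ₚ-congʳ : ∀ p {r r′} → r ≋ r′ → p *ₚ r ≋ p *ₚ r′
*ₚ-congʳ []      _   = ≋-refl
*ₚ-congʳ (a ∷ p) r≋r′ = +ₚ-cong (scaleₚ-cong a r≋r′) (∷-cong refl (*ₚ-congʳ p r≋r′))

*ₚ-zeroʳ : ∀ p → p *ₚ 0ₚ ≋ 0ₚ
*ₚ-zeroʳ []      = ≋-refl
*ₚ-zeroʳ (a ∷ p) = 0∷-≋0ₚ (*ₚ-zeroʳ p)

*ₚ-∷ʳ : ∀ p b r → p *ₚ (b ∷ r) ≋ scaleₚ b p +ₚ (+ 0 ∷ p *ₚ r)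
*ₚ-∷ʳ []      b r = ≋-sym (0∷-≋0ₚ ≋-refl)
*ₚ-∷ʳ (a ∷ p) b r = ∷-cong (cong (ℤ._+ + 0) (ℤ.*-comm a b))
  (≋-trans (+ₚ-cong ≋-refl (*ₚ-∷ʳ p b r)) (+ₚ-leftComm (scaleₚ a r) (scaleₚ b p) _))

*ₚ-comm : ∀ p r → p *ₚ r ≋ r *ₚ p
*ₚ-comm []      r = ≋-sym (*ₚ-zeroʳ r)
*ₚ-comm (a ∷ p) r = ≋-trans (+ₚ-cong ≋-refl (∷-cong refl (*ₚ-comm p r))) (≋-sym (*ₚ-∷ʳ r a p))

*ₚ-congˡ : ∀ {p p′} r → p ≋ p′ → p *ₚ r ≋ p′ *ₚ r
*ₚ-congˡ {p} {p′} r p≋p′ = ≋-trans (*ₚ-comm p r) (≋-trans (*ₚ-congʳ r p≋p′) (*ₚ-comm r p′))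

*ₚ-cong : ∀ {p p′ r r′} → p ≋ p′ → r ≋ r′ → p *ₚ r ≋ p′ *ₚ r′
*ₚ-cong {p′ = p′} {r = r} p≋p′ r≋r′ = ≋-trans (*ₚ-congˡ r p≋p′) (*ₚ-congʳ p′ r≋r′)

0∷-*ₚ : ∀ p r → (+ 0 ∷ p) *ₚ r ≋ + 0 ∷ p *ₚ r
0∷-*ₚ p r = +ₚ-cong (scaleₚ-zero r) ≋-refl

*ₚ-distribʳ-+ₚ : ∀ p r s → (p +ₚ r) *ₚ s ≋ (p *ₚ s) +ₚ (r *ₚ s)
*ₚ-distribʳ-+ₚ []      r       s = ≋-refl
*ₚ-distribʳ-+ₚ (a ∷ p) []      s = ≋-sym (+ₚ-identityʳ ((a ∷ p) *ₚ s))
*ₚ-distribʳ-+ₚ (a ∷ p) (b ∷ r) s =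
  ≋-trans (+ₚ-cong (scaleₚ-distribʳ-+ a b s) (∷-cong refl (*ₚ-distribʳ-+ₚ p r s)))
          (+ₚ-interchange (scaleₚ a s) (scaleₚ b s) (+ 0 ∷ p *ₚ s) (+ 0 ∷ r *ₚ s))

scaleₚ-*ₚ : ∀ a r s → scaleₚ a r *ₚ s ≋ scaleₚ a (r *ₚ s)
scaleₚ-*ₚ a []      s = ≋-refl
scaleₚ-*ₚ a (b ∷ r) s = begin
  scaleₚ (a ℤ.* b) s +ₚ (+ 0 ∷ (scaleₚ a r *ₚ s))           ≈⟨ +ₚ-cong (scaleₚ-assoc a b s) (∷-cong refl (scaleₚ-*ₚ a r s)) ⟩
  scaleₚ a (scaleₚ b s) +ₚ (+ 0 ∷ scaleₚ a (r *ₚ s))      ≈⟨ +ₚ-cong ≋-refl (∷-cong (sym (ℤ.*-zeroʳ a)) ≋-refl) ⟩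
  scaleₚ a (scaleₚ b s) +ₚ scaleₚ a (+ 0 ∷ r *ₚ s)        ≈⟨ scaleₚ-distribˡ-+ₚ a (scaleₚ b s) (+ 0 ∷ r *ₚ s) ⟨
  scaleₚ a (scaleₚ b s +ₚ (+ 0 ∷ r *ₚ s))                 ∎
  where open ≋-Reasoning

*ₚ-assoc : ∀ p r s → (p *ₚ r) *ₚ s ≋ p *ₚ (r *ₚ s)
*ₚ-assoc []      r s = ≋-refl
*ₚ-assoc (a ∷ p) r s = begin
  (scaleₚ a r +ₚ (+ 0 ∷ p *ₚ r)) *ₚ s               ≈⟨ *ₚ-distribʳ-+ₚ (scaleₚ a r) (+ 0 ∷ p *ₚ r) s ⟩
  (scaleₚ a r *ₚ s) +ₚ ((+ 0 ∷ p *ₚ r) *ₚ s)           ≈⟨ +ₚ-cong (scaleₚ-*ₚ a r s) (0∷-*ₚ (p *ₚ r) s) ⟩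
  scaleₚ a (r *ₚ s) +ₚ (+ 0 ∷ (p *ₚ r) *ₚ s)        ≈⟨ +ₚ-cong ≋-refl (∷-cong refl (*ₚ-assoc p r s)) ⟩
  scaleₚ a (r *ₚ s) +ₚ (+ 0 ∷ p *ₚ (r *ₚ s))        ∎
  where open ≋-Reasoning

*ₚ-commutativeSemigroup : CommutativeSemigroup 0ℓ 0ℓ
*ₚ-commutativeSemigroup = record
  { Carrier = Poly
  ; _≈_ = _≋_
  ; _∙_ = _*ₚ_
  ; isCommutativeSemigroup = record
    { isSemigroup = record
      { isMagma = record
        { isEquivalence = ≋-isEquivalence
        ; ∙-cong = *ₚ-cong
        }
      ; assoc = *ₚ-assoc
      }
    ; comm = *ₚ-comm
    }
  }

open CommutativeSemigroupProperties *ₚ-commutativeSemigroup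
  using () renaming (x∙yz≈y∙xz to *ₚ-leftComm)

*ₚ-≋0ₚʳ : ∀ p {r} → r ≋ 0ₚ → p *ₚ r ≋ 0ₚ
*ₚ-≋0ₚʳ p r≋0 = ≋-trans (*ₚ-congʳ p r≋0) (*ₚ-zeroʳ p)

signₚ-≋0ₚ : ∀ i {p} → p ≋ 0ₚ → signₚ i p ≋ 0ₚ
signₚ-≋0ₚ zero    p≋0 = p≋0
signₚ-≋0ₚ (suc i) {p} p≋0 = mk≋ λ k →
  trans (coeff--ₚ (signₚ i p) k) (cong ℤ.-_ (coeff-≡ (signₚ-≋0ₚ i p≋0) k))

sumₚ-≋0ₚ : ∀ {ps} → All (_≋ 0ₚ) ps → sumₚ ps ≋ 0ₚ
sumₚ-≋0ₚ []          = ≋-refl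
sumₚ-≋0ₚ (p≋0 ∷ ps≋0) = +ₚ-cong p≋0 (sumₚ-≋0ₚ ps≋0)

≈-zero : ∀ {A B D E} → A ≋ 0ₚ → B ≋ 0ₚ → (A /ₚ D) ≈ (B /ₚ E)
≈-zero {A} {B} {D} {E} A≋0 B≋0 = coeff-≡ (≋-trans (*ₚ-congˡ E A≋0) (≋-sym (*ₚ-congˡ D B≋0)))

/ₚ-≈-·Q : ∀ c A {D D′} → D′ ≋ c *ₚ D → (A /ₚ D) ≈ (c ·Q (A /ₚ D′))
/ₚ-≈-·Q c A {D} {D′} D′≋cD = coeff-≡ (begin
  A *ₚ D′         ≈⟨ *ₚ-congʳ A D′≋cD ⟩
  A *ₚ (c *ₚ D)   ≈⟨ *ₚ-leftComm A c D ⟩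
  c *ₚ (A *ₚ D)   ≈⟨ *ₚ-assoc c A D ⟨
  (c *ₚ A) *ₚ D   ∎)
  where open ≋-Reasoning

-- Boards with fewer rows than rooks

nrooks≤length : ∀ la → All (λ p → nrooks p ≤ length la) (rowPlacements la)
nrooks≤length []       = z≤n ∷ []
nrooks≤length (l ∷ ls) = All.concat⁺ (All.map⁺ (All.map extend (nrooks≤length ls)))
  where
  extend : ∀ {rest} → nrooks rest ≤ length ls →
           All (λ p → nrooks p ≤ suc (length ls))
               ((nothing ∷ rest) ∷ map (λ c → just c ∷ rest) (upTo l))
  extend r≤ = ℕ.m≤n⇒m≤1+n r≤ ∷ All.map⁺ (All.applyUpTo⁺₂ id l (λ _ → s≤s r≤))

Rk-vanishes : ∀ la {k} → length la < k → Rk la k ≡ 0ₚ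
Rk-vanishes la {k} ℓ<k = cong (sumₚ ∘ map (λ p → qpow (inv la p)))
  (List.filter-none (T? ∘ λ p → nrooks p ≡ᵇ k)
    (All.map (λ {p} p≤ℓ p≡k → ℕ.<⇒≢ (ℕ.≤-<-trans p≤ℓ ℓ<k) (ℕ.≡ᵇ⇒≡ (nrooks p) k p≡k))
      (All.filter⁺ _ (nrooks≤length la))))

-- The coefficients H

signₚ-0ₚ : ∀ i → signₚ i 0ₚ ≡ 0ₚ
signₚ-0ₚ zero    = refl
signₚ-0ₚ (suc i) = cong -ₚ_ (signₚ-0ₚ i)

Σ≤-suc-vanishing : ∀ n f → f (suc n) ≡ 0ₚ → Σ≤ (suc n) f ≡ Σ≤ n f
Σ≤-suc-vanishing n f fn≡0 = begin
  sumₚ (map f (upTo (suc (suc n))))                 ≡⟨ cong (sumₚ ∘ map f) (List.applyUpTo-∷ʳ id (suc n)) ⟨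
  sumₚ (map f (upTo (suc n) ++ suc n ∷ []))         ≡⟨ cong sumₚ (List.map-++ f (upTo (suc n)) (suc n ∷ [])) ⟩
  sumₚ (map f (upTo (suc n)) ++ f (suc n) ∷ [])     ≡⟨ List.foldr-++ _+ₚ_ 0ₚ (map f (upTo (suc n))) (f (suc n) ∷ []) ⟩
  foldr _+ₚ_ (f (suc n) +ₚ 0ₚ) (map f (upTo (suc n))) ≡⟨ cong (λ r → foldr _+ₚ_ (r +ₚ 0ₚ) (map f (upTo (suc n)))) fn≡0 ⟩
  Σ≤ n f                                            ∎
  where open ≡-Reasoning

length-+ₓ-≤ : ∀ {L} ps qs → length ps ≤ L → length qs ≤ L → length (ps +ₓ qs) ≤ L
length-+ₓ-≤         []       qs       _         qs≤ = qs≤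
length-+ₓ-≤         (p ∷ ps) []       ps≤       _   = ps≤
length-+ₓ-≤ {suc L} (p ∷ ps) (q ∷ qs) (s≤s ps≤) (s≤s qs≤) = s≤s (length-+ₓ-≤ ps qs ps≤ qs≤)

length-xqPoch : ∀ i → length (xqPoch i) ≤ suc i
length-xqPoch zero    = s≤s z≤n
length-xqPoch (suc i) = length-+ₓ-≤ (xqPoch i) _ (ℕ.m≤n⇒m≤1+n (length-xqPoch i))
  (s≤s (ℕ.≤-trans (ℕ.≤-reflexive (List.length-map _ (xqPoch i))) (length-xqPoch i)))

coeffₓ-beyond : ∀ ps {j} → length ps ≤ j → coeffₓ ps j ≡ 0ₚ
coeffₓ-beyond []       _         = refl
coeffₓ-beyond (p ∷ ps) (s≤s ps≤) = coeffₓ-beyond ps ps≤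

coeffₓ-xqPoch-vanishes : ∀ {i j} → i < j → coeffₓ (xqPoch i) j ≡ 0ₚ
coeffₓ-xqPoch-vanishes {i} i<j = coeffₓ-beyond (xqPoch i) (ℕ.≤-trans (length-xqPoch i) i<j)

Hterm : ℕ → List ℕ → ℕ → ℕ → Poly
Hterm m la j i =
  signₚ i (Rk la i *ₚ (qfact (m ∸ i) *ₚ (qpow (m ℕ.* i ∸ choose2 i) *ₚ coeffₓ (xqPoch i) j)))

Hnum-suc : ∀ m n la j → length la ≤ n → Hnum m (suc n) la j ≡ Hnum m n la j
Hnum-suc m n la j ℓ≤n = Σ≤-suc-vanishing n (Hterm m la j)
  (trans (cong (λ R → signₚ (suc n) (R *ₚ _)) (Rk-vanishes la (s≤s ℓ≤n))) (signₚ-0ₚ (suc n)))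

Hnum-vanishes : ∀ m n la {j} → n < j → Hnum m n la j ≋ 0ₚ
Hnum-vanishes m n la {j} n<j = sumₚ-≋0ₚ (All.map⁺ (All.applyUpTo⁺₁ id (suc n) Hterm-vanishes))
  where
  Hterm-vanishes : ∀ {i} → i < suc n → Hterm m la j i ≋ 0ₚ
  Hterm-vanishes {i} i<1+n =
    signₚ-≋0ₚ i (*ₚ-≋0ₚʳ (Rk la i) (*ₚ-≋0ₚʳ (qfact (m ∸ i)) (*ₚ-≋0ₚʳ (qpow (m ℕ.* i ∸ choose2 i))
      (≋-reflexive (coeffₓ-xqPoch-vanishes (ℕ.<-≤-trans i<1+n n<j))))))

H-≤ : ∀ m n la {j} → j ≤ n → H m n la (+ j) ≡ Hnum m n la j /ₚ (qpow (size la) *ₚ qfact (m ∸ n))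
H-≤ m n la {j} j≤n with j ≤ᵇ n | ℕ.≤⇒≤ᵇ j≤n
... | true | _ = refl

H-> : ∀ m n la {j} → n < j → H m n la (+ j) ≡ 0Q
H-> m n la {j} n<j with j ≤ᵇ n | ℕ.≤ᵇ⇒≤ j n
... | true  | j≤n = ⊥-elim (ℕ.<⇒≱ n<j (j≤n _))
... | false | _   = refl

H-≈-zero : ∀ m n la {j B E} → Hnum m n la j ≋ 0ₚ → B ≋ 0ₚ → H m n la (+ j) ≈ (B /ₚ E)
H-≈-zero m n la {j} {E = E} Hnum≋0 B≋0 with j ≤ᵇ n
... | true  = ≈-zero Hnum≋0 B≋0
... | false = ≈-zero {D = 1ₚ} {E = E} ≋-refl B≋0

lemma2p14 : (m n : ℕ) → 1 ≤ n → n ≤ m → (la : List ℕ) → IsPartition la → Inside (n ∸ 1) m la → (j : ℤ) → H m n la j ≈ (qnum (suc m ∸ n) ·Q H m (n ∸ 1) la j)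
lemma2p14 m (suc n) _ n<m la _ (ℓ≤n , _) -[1+ _ ] = ≈-zero {D = 1ₚ} {E = 1ₚ} ≋-refl (*ₚ-zeroʳ (qnum (m ∸ n)))
lemma2p14 m (suc n) _ n<m la _ (ℓ≤n , _) (+ j) with j ℕ.≤? n
... | no j≰n rewrite H-> m n la (ℕ.≰⇒> j≰n) =
  H-≈-zero m (suc n) la
    (≋-trans (≋-reflexive (Hnum-suc m n la j ℓ≤n)) (Hnum-vanishes m n la (ℕ.≰⇒> j≰n)))
    (*ₚ-zeroʳ (qnum (m ∸ n)))
... | yes j≤n
  rewrite H-≤ m (suc n) la (ℕ.m≤n⇒m≤1+n j≤n) | H-≤ m n la j≤n | Hnum-suc m n la j ℓ≤n
        | ℕ.+-∸-assoc 1 n<m =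
  -- the last rewrite exposes [m − n]! = [m − n] · [m − n − 1]!
  /ₚ-≈-·Q (qnum (suc (m ∸ suc n))) (Hnum m n la j)
    (*ₚ-leftComm (qpow (size la)) (qnum (suc (m ∸ suc n))) (qfact (m ∸ suc n)))
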